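{- Let $p,q$ be indeterminates. For every integer $n\geq 1$, \[ A_{2n}(p,q)=(1+p)A_{2n-1}(p,q)+(p+q)\sum_{i=1}^{n-1}\binom{2n-1}{2i-1}A_{2i-1}(p,q)A_{2n-2i}(p,q), \] and \[ A_{2n+1}(p,q)=A_{2n}(p,q)+p\sum_{i=0}^{n-1}\binom{2n}{2i}A_{2i}(p,q)A_{2n-2i}(q,p)+q\sum_{i=1}^{n}\binom{2n}{2i-1}A_{2i-1}(p,q)A_{2n-2i+1}(p,q). \]
   Context: $\mathfrak{S}_n$ is the set of permutations of $[n]=\{1,\dots,n\}$. For $\pi=a_1a_2\cdots a_n\in\mathfrak{S}_n$, an index $i\in[n-1]$ is a descent if $a_i>a_{i+1}$; $\mathrm{odes}(\pi)$ (resp. $\mathrm{edes}(\pi)$) is the number of descents $i$ with $i$ odd (resp. even). The refined Eulerian polynomials are $A_n(p,q)=\sum_{\pi\in\mathfrak{S}_n}p^{\mathrm{odes}(\pi)}q^{\mathrm{edes}(\pi)}$ for $n\geq1$, and $A_0(p,q)=1$. $A_n(q,p)$ denotes $A_n$ with the roles of the two variables exchanged. -}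

module Defs where

open import Level using (Level)
open import Data.Bool using (Bool; true; false; if_then_else_; not)
open import Data.Nat using (ℕ; zero; suc; _<ᵇ_)
import Data.Nat.Properties as ℕP
open import Data.List using (List; []; _∷_; map; concatMap; applyUpTo; filter; foldr; upTo)
open import Data.List.Relation.Unary.Unique.DecPropositional ℕP._≟_ using (unique?)
open import Algebra.Bundles using (CommutativeSemiring)

words : ℕ → ℕ → List (List ℕ)
words zero    n = [] ∷ []
words (suc k) n = concatMap (λ w → map (λ a → a ∷ w) (applyUpTo suc n)) (words k n)

-- 𝔖_n : the permutations of [n] in one-line notation a₁a₂⋯aₙ, i.e. the
-- words of length n over [n] with pairwise distinct letters.
perms : ℕ → List (List ℕ)
perms n = filter unique? (words n n)

module _ {c ℓ : Level} (R : CommutativeSemiring c ℓ) where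
  open CommutativeSemiring R

  fromℕ : ℕ → Carrier
  fromℕ zero    = 0#
  fromℕ (suc n) = 1# + fromℕ n

  sumR : List Carrier → Carrier
  sumR = foldr _+_ 0#

  -- Σ_{i = a}^{b} f i  (empty when b < a)
  Σ[_⋯_] : ℕ → ℕ → (ℕ → Carrier) → Carrier
  Σ[ a ⋯ b ] f = sumR (map (λ j → f (a Data.Nat.+ j)) (upTo (suc b Data.Nat.∸ a)))

  -- p^{odes(π)} q^{edes(π)}; the Bool records whether the current index
  -- i (of the pair a_i, a_{i+1}) is odd.  Indices start at 1 (odd).
  desWeight : Carrier → Carrier → Bool → List ℕ → Carrier
  desWeight p q odd (a ∷ b ∷ t) =
    (if b <ᵇ a then (if odd then p else q) else 1#) * desWeight p q (not odd) (b ∷ t)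
  desWeight p q odd _ = 1#

  -- refined Eulerian polynomial A_n(p,q), evaluated at p q ∈ R
  -- (A_0 = 1 since 𝔖_0 consists of the empty word only)
  A : ℕ → Carrier → Carrier → Carrier
  A n p q = sumR (map (desWeight p q true) (perms n))

module Submission where

-- All sums are sums over arrangements: ∑Arr n L f adds f over the
-- sequences of n distinct entries of the list L, and A_n(p, q) is ∑Arr n [1..n] of the
-- descent weight.  Three general facts about ∑Arr do the combinatorics:
--   * insertion: arrangements of M ∷ L arise by inserting M into those of L;
--   * shuffling: a weight that factors through a prefix of length k and the rest sums
--     to a sum over the C(|L|, k) ways of splitting L into two subsequences;
--   * relabelling: the descent weight only sees relative order, so every sorted
--     alphabet of size n gives the same total A_n.
-- Together they give the binomial convolutions obtained by inserting the maximum
-- (maxInsertion) or the minimum (minInsertion) into a permutation; the parity of the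
-- insertion place decides whether a factor p or q appears and whether the right part
-- is read as A(p, q) or A(q, p).  Splitting these sums by parity gives the recurrence
-- for A_{2n+1} (second identity).  Comparing the two insertions proves, by strong
-- induction, that A_{2k+1} is symmetric in p and q, and with this the maximum
-- insertion for A_{2k+2} collapses to the first identity.

open import Defs
open import Level using (Level; _⊔_)
open import Function using (_∘_; id)
open import Data.Bool using (Bool; true; false; if_then_else_; not; _∧_)
open import Data.Bool.Properties using (∧-comm; not-involutive)
open import Data.Empty using (⊥)
open import Data.Unit using (tt)
open import Data.Product using (_×_; _,_)
open import Data.Sum using (_⊎_; inj₁; inj₂)
open import Data.Nat as ℕ using (ℕ; zero; suc; _∸_; _≤_; _<_; _≟_; _<?_; _<ᵇ_; z≤n; s≤s)
import Data.Nat.Properties as ℕP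
open import Data.Nat.Combinatorics using (_C_; nCk+nC[k+1]≡[n+1]C[k+1]; nCn≡1; nCk≡nC[n∸k])
open import Data.Nat.Induction using (<-rec)
open import Data.List using (List; []; _∷_; map; concatMap; applyUpTo; applyDownFrom; filter; upTo; _++_; length; take; drop)
import Data.List.Properties as LP
open import Data.List.Relation.Unary.All as All using (All; []; _∷_)
import Data.List.Relation.Unary.All.Properties as AllP
open import Data.List.Relation.Unary.AllPairs as AllPairs using (AllPairs; []; _∷_)
import Data.List.Relation.Unary.AllPairs.Properties as AllPairsP
open import Data.List.Relation.Unary.Unique.Propositional using (Unique)
open import Data.List.Relation.Unary.Unique.DecPropositional _≟_ using (unique?)
open import Data.List.Relation.Binary.Pointwise as PW using (Pointwise; []; _∷_)
open import Data.List.Relation.Binary.Permutation.Propositional using (_↭_)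
import Data.List.Relation.Binary.Permutation.Propositional as Perm
import Data.List.Relation.Binary.Permutation.Propositional.Properties as PermP
open import Relation.Nullary using (Dec; does; ¬?)
open import Relation.Nullary.Decidable using (dec-true; dec-false)
open import Relation.Binary.PropositionalEquality as ≡ using (_≡_; _≢_)
open import Algebra.Bundles using (CommutativeSemiring)

module Eulerian {c ℓ : Level} (R : CommutativeSemiring c ℓ) where
  open CommutativeSemiring R hiding (zero)
  open import Relation.Binary.Reasoning.Setoid setoid
  open import Algebra.Properties.CommutativeSemigroup +-commutativeSemigroup using (interchange; x∙yz≈y∙xz)

  ∑ : {X : Set} → (X → Carrier) → List X → Carrier
  ∑ f xs = sumR R (map f xs)

  ∑-cong : {X : Set} {f g : X → Carrier} (xs : List X) → (∀ x → f x ≈ g x) → ∑ f xs ≈ ∑ g xs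
  ∑-cong []       f≈g = refl
  ∑-cong (x ∷ xs) f≈g = +-cong (f≈g x) (∑-cong xs f≈g)

  ∑-congᴬ : {X : Set} {P : X → Set} {f g : X → Carrier} {xs : List X} →
            All P xs → (∀ x → P x → f x ≈ g x) → ∑ f xs ≈ ∑ g xs
  ∑-congᴬ []         f≈g = refl
  ∑-congᴬ (px ∷ pxs) f≈g = +-cong (f≈g _ px) (∑-congᴬ pxs f≈g)

  ∑-pointwise : {X Y : Set} {S : X → Y → Set} {f : X → Carrier} {g : Y → Carrier} {xs : List X} {ys : List Y} →
                Pointwise S xs ys → (∀ {x y} → S x y → f x ≈ g y) → ∑ f xs ≈ ∑ g ys
  ∑-pointwise []       f≈g = refl
  ∑-pointwise (s ∷ ss) f≈g = +-cong (f≈g s) (∑-pointwise ss f≈g)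

  ∑-++ : {X : Set} (f : X → Carrier) (xs ys : List X) → ∑ f (xs ++ ys) ≈ ∑ f xs + ∑ f ys
  ∑-++ f []       ys = sym (+-identityˡ _)
  ∑-++ f (x ∷ xs) ys = trans (+-congˡ (∑-++ f xs ys)) (sym (+-assoc _ _ _))

  ∑-map : {X Y : Set} (f : Y → Carrier) (g : X → Y) (xs : List X) → ∑ f (map g xs) ≈ ∑ (f ∘ g) xs
  ∑-map f g xs = reflexive (≡.cong (sumR R) (≡.sym (LP.map-∘ xs)))

  ∑-concatMap : {X Y : Set} (f : Y → Carrier) (h : X → List Y) (xs : List X) →
                ∑ f (concatMap h xs) ≈ ∑ (λ x → ∑ f (h x)) xs
  ∑-concatMap f h []       = refl
  ∑-concatMap f h (x ∷ xs) = trans (∑-++ f (h x) (concatMap h xs)) (+-congˡ (∑-concatMap f h xs))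

  ∑-zero : {X : Set} (xs : List X) → ∑ (λ _ → 0#) xs ≈ 0#
  ∑-zero []       = refl
  ∑-zero (x ∷ xs) = trans (+-identityˡ _) (∑-zero xs)

  ∑-const : {X : Set} (a : Carrier) (xs : List X) → ∑ (λ _ → a) xs ≈ fromℕ R (length xs) * a
  ∑-const a []       = sym (zeroˡ a)
  ∑-const a (x ∷ xs) = trans (+-cong (sym (*-identityˡ a)) (∑-const a xs)) (sym (distribʳ a 1# _))

  ∑-+ : {X : Set} (f g : X → Carrier) (xs : List X) → ∑ (λ x → f x + g x) xs ≈ ∑ f xs + ∑ g xs
  ∑-+ f g []       = sym (+-identityˡ 0#)
  ∑-+ f g (x ∷ xs) = trans (+-congˡ (∑-+ f g xs)) (interchange _ _ _ _)

  ∑-*ˡ : {X : Set} (a : Carrier) (f : X → Carrier) (xs : List X) → a * ∑ f xs ≈ ∑ (λ x → a * f x) xs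
  ∑-*ˡ a f []       = zeroʳ a
  ∑-*ˡ a f (x ∷ xs) = trans (distribˡ a _ _) (+-congˡ (∑-*ˡ a f xs))

  ∑-*ʳ : {X : Set} (a : Carrier) (f : X → Carrier) (xs : List X) → ∑ f xs * a ≈ ∑ (λ x → f x * a) xs
  ∑-*ʳ a f xs = trans (*-comm _ _) (trans (∑-*ˡ a f xs) (∑-cong xs (λ x → *-comm _ _)))

  ∑-swap : {X Y : Set} (f : X → Y → Carrier) (xs : List X) (ys : List Y) →
           ∑ (λ x → ∑ (f x) ys) xs ≈ ∑ (λ y → ∑ (λ x → f x y) xs) ys
  ∑-swap f []       ys = sym (∑-zero ys)
  ∑-swap f (x ∷ xs) ys = trans (+-congˡ (∑-swap f xs ys)) (sym (∑-+ (f x) _ ys))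

  ∑-↭ : {X : Set} (f : X → Carrier) {xs ys : List X} → xs ↭ ys → ∑ f xs ≈ ∑ f ys
  ∑-↭ f Perm.refl          = refl
  ∑-↭ f (Perm.prep x p)    = +-congˡ (∑-↭ f p)
  ∑-↭ f (Perm.swap x y p)  = trans (+-congˡ (+-congˡ (∑-↭ f p))) (x∙yz≈y∙xz _ _ _)
  ∑-↭ f (Perm.trans p q)   = trans (∑-↭ f p) (∑-↭ f q)

  guard : Bool → Carrier → Carrier
  guard b v = if b then v else 0#

  guard-cong : (b : Bool) {v w : Carrier} → v ≈ w → guard b v ≈ guard b w
  guard-cong true  v≈w = v≈w
  guard-cong false v≈w = refl

  guard-∧ : (a b : Bool) (v : Carrier) → guard (a ∧ b) v ≈ guard a (guard b v)
  guard-∧ true  b v = refl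
  guard-∧ false b v = refl

  ∑-guard : {X : Set} (b : Bool) (f : X → Carrier) (xs : List X) → ∑ (λ x → guard b (f x)) xs ≈ guard b (∑ f xs)
  ∑-guard true  f xs = refl
  ∑-guard false f xs = ∑-zero xs

  ∑-filter : {X : Set} {P : X → Set} (P? : ∀ x → Dec (P x)) (f : X → Carrier) (xs : List X) →
             ∑ f (filter P? xs) ≈ ∑ (λ x → guard (does (P? x)) (f x)) xs
  ∑-filter P? f []       = refl
  ∑-filter P? f (x ∷ xs) with does (P? x)
  ... | true  = +-congˡ (∑-filter P? f xs)
  ... | false = trans (∑-filter P? f xs) (sym (+-identityˡ _))

  Σ< : ℕ → (ℕ → Carrier) → Carrier
  Σ< n f = ∑ f (upTo n)

  Σ<-cong : ∀ n {f g : ℕ → Carrier} → (∀ i → i < n → f i ≈ g i) → Σ< n f ≈ Σ< n g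
  Σ<-cong n f≈g = ∑-congᴬ (AllP.applyUpTo⁺₁ id n id) f≈g

  Σ<-suc : ∀ n (f : ℕ → Carrier) → Σ< (suc n) f ≈ f 0 + Σ< n (f ∘ suc)
  Σ<-suc n f = +-congˡ (reflexive (≡.cong (sumR R)
    (≡.trans (LP.map-applyUpTo suc f n) (≡.sym (LP.map-applyUpTo id (f ∘ suc) n)))))

  Σ<-last : ∀ n (f : ℕ → Carrier) → Σ< (suc n) f ≈ Σ< n f + f n
  Σ<-last zero    f = trans (+-identityʳ _) (sym (+-identityˡ _))
  Σ<-last (suc n) f = begin
    Σ< (suc (suc n)) f                  ≈⟨ Σ<-suc (suc n) f ⟩
    f 0 + Σ< (suc n) (f ∘ suc)          ≈⟨ +-congˡ (Σ<-last n (f ∘ suc)) ⟩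
    f 0 + (Σ< n (f ∘ suc) + f (suc n))  ≈⟨ sym (+-assoc _ _ _) ⟩
    (f 0 + Σ< n (f ∘ suc)) + f (suc n)  ≈⟨ +-congʳ (sym (Σ<-suc n f)) ⟩
    Σ< (suc n) f + f (suc n)            ∎

  Σ<-split : ∀ a b (f : ℕ → Carrier) → Σ< (a ℕ.+ b) f ≈ Σ< a f + Σ< b (λ j → f (a ℕ.+ j))
  Σ<-split zero    b f = sym (+-identityˡ _)
  Σ<-split (suc a) b f = begin
    Σ< (suc (a ℕ.+ b)) f                                     ≈⟨ Σ<-suc (a ℕ.+ b) f ⟩
    f 0 + Σ< (a ℕ.+ b) (f ∘ suc)                             ≈⟨ +-congˡ (Σ<-split a b (f ∘ suc)) ⟩
    f 0 + (Σ< a (f ∘ suc) + Σ< b (λ j → f (suc a ℕ.+ j)))    ≈⟨ sym (+-assoc _ _ _) ⟩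
    (f 0 + Σ< a (f ∘ suc)) + Σ< b (λ j → f (suc a ℕ.+ j))    ≈⟨ +-congʳ (sym (Σ<-suc a f)) ⟩
    Σ< (suc a) f + Σ< b (λ j → f (suc a ℕ.+ j))              ∎

  Σ<-reverse : ∀ n (f : ℕ → Carrier) → Σ< n f ≈ Σ< n (λ i → f (n ∸ suc i))
  Σ<-reverse zero    f = refl
  Σ<-reverse (suc n) f = begin
    Σ< (suc n) f                          ≈⟨ Σ<-last n f ⟩
    Σ< n f + f n                          ≈⟨ +-congʳ (Σ<-reverse n f) ⟩
    Σ< n (λ i → f (n ∸ suc i)) + f n      ≈⟨ +-comm _ _ ⟩
    f n + Σ< n (λ i → f (n ∸ suc i))      ≈⟨ sym (Σ<-suc n (λ i → f (suc n ∸ suc i))) ⟩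
    Σ< (suc n) (λ i → f (suc n ∸ suc i))  ∎

  Σ<-pairs : ∀ n (f : ℕ → Carrier) → Σ< (2 ℕ.* n) f ≈ Σ< n (λ i → f (2 ℕ.* i) + f (suc (2 ℕ.* i)))
  Σ<-pairs zero    f = refl
  Σ<-pairs (suc n) f = begin
    Σ< (2 ℕ.* suc n) f                                 ≡⟨ ≡.cong (λ m → Σ< m f) (ℕP.*-suc 2 n) ⟩
    Σ< (suc (suc (2 ℕ.* n))) f                         ≈⟨ Σ<-suc (suc (2 ℕ.* n)) f ⟩
    f 0 + Σ< (suc (2 ℕ.* n)) (f ∘ suc)                 ≈⟨ +-congˡ (Σ<-suc (2 ℕ.* n) (f ∘ suc)) ⟩
    f 0 + (f 1 + Σ< (2 ℕ.* n) (f ∘ suc ∘ suc))         ≈⟨ sym (+-assoc _ _ _) ⟩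
    (f 0 + f 1) + Σ< (2 ℕ.* n) (f ∘ suc ∘ suc)         ≈⟨ +-congˡ (Σ<-pairs n (f ∘ suc ∘ suc)) ⟩
    (f 0 + f 1) + Σ< n (λ i → f (2 ℕ.+ 2 ℕ.* i) + f (3 ℕ.+ 2 ℕ.* i))
      ≈⟨ +-congˡ (∑-cong (upTo n) (λ i → reflexive (≡.cong (λ m → f m + f (suc m)) (≡.sym (ℕP.*-suc 2 i))))) ⟩
    (f 0 + f 1) + Σ< n (λ i → f (2 ℕ.* suc i) + f (suc (2 ℕ.* suc i)))
      ≈⟨ sym (Σ<-suc n _) ⟩
    Σ< (suc n) (λ i → f (2 ℕ.* i) + f (suc (2 ℕ.* i))) ∎

  Σ<-linear : ∀ n a b (f g : ℕ → Carrier) → Σ< n (λ i → a * f i + b * g i) ≈ a * Σ< n f + b * Σ< n g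
  Σ<-linear n a b f g = trans (∑-+ _ _ (upTo n)) (sym (+-cong (∑-*ˡ a f (upTo n)) (∑-*ˡ b g (upTo n))))

  wordsOver : ℕ → List ℕ → List (List ℕ)
  wordsOver zero    L = [] ∷ []
  wordsOver (suc k) L = concatMap (λ w → map (_∷ w) L) (wordsOver k L)

  words≡wordsOver : ∀ k n → words k n ≡ wordsOver k (applyUpTo suc n)
  words≡wordsOver zero    n = ≡.refl
  words≡wordsOver (suc k) n = ≡.cong (concatMap (λ w → map (_∷ w) (applyUpTo suc n))) (words≡wordsOver k n)

  ∑-wordsOver-suc : ∀ k L (g : List ℕ → Carrier) →
                    ∑ g (wordsOver (suc k) L) ≈ ∑ (λ w → ∑ (λ a → g (a ∷ w)) L) (wordsOver k L)
  ∑-wordsOver-suc k L g = trans (∑-concatMap g _ (wordsOver k L)) (∑-cong (wordsOver k L) (λ w → ∑-map g _ L))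

  ∑-wordsOver-↭ : ∀ k {L L′} → L ↭ L′ → (g : List ℕ → Carrier) → ∑ g (wordsOver k L) ≈ ∑ g (wordsOver k L′)
  ∑-wordsOver-↭ zero    L↭L′ g = refl
  ∑-wordsOver-↭ (suc k) {L} {L′} L↭L′ g = begin
    ∑ g (wordsOver (suc k) L)                         ≈⟨ ∑-wordsOver-suc k L g ⟩
    ∑ (λ w → ∑ (λ a → g (a ∷ w)) L) (wordsOver k L)   ≈⟨ ∑-cong (wordsOver k L) (λ w → ∑-↭ _ L↭L′) ⟩
    ∑ (λ w → ∑ (λ a → g (a ∷ w)) L′) (wordsOver k L)  ≈⟨ ∑-wordsOver-↭ k L↭L′ _ ⟩
    ∑ (λ w → ∑ (λ a → g (a ∷ w)) L′) (wordsOver k L′) ≈⟨ sym (∑-wordsOver-suc k L′ g) ⟩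
    ∑ g (wordsOver (suc k) L′)                        ∎

  -- distinct w is the test by which Defs.perms selects permutations; on a ∷ w it is
  -- avoids a w ∧ distinct w.
  avoids : ℕ → List ℕ → Bool
  avoids a w = does (All.all? (λ y → ¬? (a ≟ y)) w)

  distinct : List ℕ → Bool
  distinct w = does (unique? w)

  remove : ℕ → List ℕ → List ℕ
  remove a L = filter (λ b → ¬? (a ≟ b)) L

  ∑-avoiding : ∀ k a L (g : List ℕ → Carrier) →
               ∑ (λ w → guard (avoids a w) (g w)) (wordsOver k L) ≈ ∑ g (wordsOver k (remove a L))
  ∑-avoiding zero    a L g = refl
  ∑-avoiding (suc k) a L g = begin
    ∑ (λ w → guard (avoids a w) (g w)) (wordsOver (suc k) L)
      ≈⟨ ∑-wordsOver-suc k L _ ⟩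
    ∑ (λ w → ∑ (λ b → guard (not (does (a ≟ b)) ∧ avoids a w) (g (b ∷ w))) L) (wordsOver k L)
      ≈⟨ ∑-cong (wordsOver k L) firstLetter ⟩
    ∑ (λ w → guard (avoids a w) (∑ (λ b → g (b ∷ w)) (remove a L))) (wordsOver k L)
      ≈⟨ ∑-avoiding k a L _ ⟩
    ∑ (λ w → ∑ (λ b → g (b ∷ w)) (remove a L)) (wordsOver k (remove a L))
      ≈⟨ sym (∑-wordsOver-suc k (remove a L) g) ⟩
    ∑ g (wordsOver (suc k) (remove a L)) ∎
    where
    firstLetter : ∀ w → ∑ (λ b → guard (not (does (a ≟ b)) ∧ avoids a w) (g (b ∷ w))) L
                      ≈ guard (avoids a w) (∑ (λ b → g (b ∷ w)) (remove a L))
    firstLetter w = begin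
      ∑ (λ b → guard (not (does (a ≟ b)) ∧ avoids a w) (g (b ∷ w))) L
        ≈⟨ ∑-cong L (λ b → reflexive (≡.cong (λ z → guard z _) (∧-comm (not (does (a ≟ b))) (avoids a w)))) ⟩
      ∑ (λ b → guard (avoids a w ∧ not (does (a ≟ b))) (g (b ∷ w))) L
        ≈⟨ ∑-cong L (λ b → guard-∧ (avoids a w) (not (does (a ≟ b))) _) ⟩
      ∑ (λ b → guard (avoids a w) (guard (not (does (a ≟ b))) (g (b ∷ w)))) L
        ≈⟨ ∑-guard (avoids a w) _ L ⟩
      guard (avoids a w) (∑ (λ b → guard (not (does (a ≟ b))) (g (b ∷ w))) L)
        ≈⟨ guard-cong (avoids a w) (sym (∑-filter (λ b → ¬? (a ≟ b)) _ L)) ⟩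
      guard (avoids a w) (∑ (λ b → g (b ∷ w)) (remove a L)) ∎

  ∑Distinct : ℕ → List ℕ → (List ℕ → Carrier) → Carrier
  ∑Distinct k L f = ∑ (λ w → guard (distinct w) (f w)) (wordsOver k L)

  ∑Distinct-suc : ∀ k L f → ∑Distinct (suc k) L f ≈ ∑ (λ a → ∑Distinct k (remove a L) (f ∘ (a ∷_))) L
  ∑Distinct-suc k L f = begin
    ∑Distinct (suc k) L f
      ≈⟨ ∑-wordsOver-suc k L _ ⟩
    ∑ (λ w → ∑ (λ a → guard (avoids a w ∧ distinct w) (f (a ∷ w))) L) (wordsOver k L)
      ≈⟨ ∑-swap _ (wordsOver k L) L ⟩
    ∑ (λ a → ∑ (λ w → guard (avoids a w ∧ distinct w) (f (a ∷ w))) (wordsOver k L)) L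
      ≈⟨ ∑-cong L (λ a → ∑-cong (wordsOver k L) (λ w → guard-∧ (avoids a w) (distinct w) _)) ⟩
    ∑ (λ a → ∑ (λ w → guard (avoids a w) (guard (distinct w) (f (a ∷ w)))) (wordsOver k L)) L
      ≈⟨ ∑-cong L (λ a → ∑-avoiding k a L _) ⟩
    ∑ (λ a → ∑Distinct k (remove a L) (f ∘ (a ∷_))) L ∎

  picks : List ℕ → List (ℕ × List ℕ)
  picks []      = []
  picks (x ∷ L) = (x , L) ∷ map (λ { (a , S) → a , x ∷ S }) (picks L)

  -- ∑Arr n L f sums f over the arrangements of n entries of L (ordered selections
  -- without repetition of positions).  It is the combinatorial workhorse below.
  ∑Arr : ℕ → List ℕ → (List ℕ → Carrier) → Carrier
  ∑Arr zero    L f = f []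
  ∑Arr (suc n) L f = ∑ (λ { (a , S) → ∑Arr n S (f ∘ (a ∷_)) }) (picks L)

  picks-All : {P : ℕ → Set} {L : List ℕ} → All P L → All (λ { (a , S) → P a × All P S }) (picks L)
  picks-All []         = []
  picks-All (px ∷ pxs) = (px , pxs) ∷ AllP.map⁺ (All.map (λ { (pa , pS) → pa , px ∷ pS }) (picks-All pxs))

  picks-length : ∀ k L → length L ≡ suc k → All (λ { (a , S) → length S ≡ k }) (picks L)
  picks-length k       (x ∷ [])    ≡.refl = ≡.refl ∷ []
  picks-length (suc k) (x ∷ y ∷ L) eq     =
    ≡.cong ℕ.pred eq ∷ AllP.map⁺ (All.map (≡.cong suc) (picks-length k (y ∷ L) (≡.cong ℕ.pred eq)))

  picks-unique : {L : List ℕ} → Unique L → All (λ { (a , S) → Unique S }) (picks L)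
  picks-unique []         = []
  picks-unique (px ∷ uL) =
    uL ∷ AllP.map⁺ (All.zipWith (λ { (uS , _ , x∉S) → x∉S ∷ uS }) (picks-unique uL , picks-All px))

  picks≡remove : {L : List ℕ} → Unique L → picks L ≡ map (λ a → a , remove a L) L
  picks≡remove {[]}    []         = ≡.refl
  picks≡remove {x ∷ L} (px ∷ uL) = ≡.cong₂ _∷_ (≡.cong (x ,_) (≡.sym removeHead))
    (≡.trans (≡.cong (map _) (picks≡remove uL))
    (≡.trans (≡.sym (LP.map-∘ L)) (LP.map-cong-local (All.map keepHead px))))
    where
    removeHead : remove x (x ∷ L) ≡ L
    removeHead = ≡.trans (LP.filter-reject (λ b → ¬? (x ≟ b)) (λ x≢x → x≢x ≡.refl)) (LP.filter-all (λ b → ¬? (x ≟ b)) px)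
    keepHead : ∀ {a} → x ≢ a → (a , x ∷ remove a L) ≡ (a , remove a (x ∷ L))
    keepHead x≢a = ≡.cong (_ ,_) (≡.sym (LP.filter-accept (λ b → ¬? (_ ≟ b)) (λ a≡x → x≢a (≡.sym a≡x))))

  ∑Distinct≈∑Arr : ∀ k L f → Unique L → length L ≡ k → ∑Distinct k L f ≈ ∑Arr k L f
  ∑Distinct≈∑Arr zero    L f uL eq = +-identityʳ _
  ∑Distinct≈∑Arr (suc k) L f uL eq = begin
    ∑Distinct (suc k) L f                                            ≈⟨ ∑Distinct-suc k L f ⟩
    ∑ (λ a → ∑Distinct k (remove a L) (f ∘ (a ∷_))) L                ≈⟨ sym (∑-map _ _ L) ⟩
    ∑ (λ { (a , S) → ∑Distinct k S (f ∘ (a ∷_)) }) (map (λ a → a , remove a L) L)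
      ≡⟨ ≡.cong (∑ _) (≡.sym (picks≡remove uL)) ⟩
    ∑ (λ { (a , S) → ∑Distinct k S (f ∘ (a ∷_)) }) (picks L)
      ≈⟨ ∑-congᴬ (All.zip (picks-unique uL , picks-length k L eq)) (λ { (a , S) (uS , lenS) → ∑Distinct≈∑Arr k S _ uS lenS }) ⟩
    ∑Arr (suc k) L f ∎

  ∑Arr-congᴬ : ∀ n {P : ℕ → Set} {L f g} → All P L →
               (∀ w → length w ≡ n → All P w → f w ≈ g w) → ∑Arr n L f ≈ ∑Arr n L g
  ∑Arr-congᴬ zero    pL f≈g = f≈g [] ≡.refl []
  ∑Arr-congᴬ (suc n) pL f≈g = ∑-congᴬ (picks-All pL) (λ { (a , S) (pa , pS) →
    ∑Arr-congᴬ n pS (λ w eq pw → f≈g (a ∷ w) (≡.cong suc eq) (pa ∷ pw)) })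

  ∑Arr-congˡ : ∀ n {L f g} → (∀ w → length w ≡ n → f w ≈ g w) → ∑Arr n L f ≈ ∑Arr n L g
  ∑Arr-congˡ n {L} f≈g = ∑Arr-congᴬ n (All.universal (λ _ → tt) L) (λ w eq _ → f≈g w eq)

  ∑Arr-cong : ∀ n {L f g} → (∀ w → f w ≈ g w) → ∑Arr n L f ≈ ∑Arr n L g
  ∑Arr-cong n f≈g = ∑Arr-congˡ n (λ w _ → f≈g w)

  ∑Arr-zero : ∀ n L → ∑Arr n L (λ _ → 0#) ≈ 0#
  ∑Arr-zero zero    L = refl
  ∑Arr-zero (suc n) L = trans (∑-cong (picks L) (λ { (a , S) → ∑Arr-zero n S })) (∑-zero (picks L))

  ∑Arr-+ : ∀ n L f g → ∑Arr n L (λ w → f w + g w) ≈ ∑Arr n L f + ∑Arr n L g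
  ∑Arr-+ zero    L f g = refl
  ∑Arr-+ (suc n) L f g = trans (∑-cong (picks L) (λ { (a , S) → ∑Arr-+ n S _ _ })) (∑-+ _ _ (picks L))

  ∑Arr-*ˡ : ∀ n L a f → ∑Arr n L (λ w → a * f w) ≈ a * ∑Arr n L f
  ∑Arr-*ˡ zero    L a f = refl
  ∑Arr-*ˡ (suc n) L a f = trans (∑-cong (picks L) (λ { (b , S) → ∑Arr-*ˡ n S a _ })) (sym (∑-*ˡ a _ (picks L)))

  ∑Arr-*ʳ : ∀ n L a f → ∑Arr n L (λ w → f w * a) ≈ ∑Arr n L f * a
  ∑Arr-*ʳ n L a f = trans (∑Arr-cong n (λ w → *-comm _ _)) (trans (∑Arr-*ˡ n L a f) (*-comm _ _))

  ∑Arr-∑ : ∀ n L {X : Set} (xs : List X) (F : X → List ℕ → Carrier) →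
           ∑Arr n L (λ w → ∑ (λ x → F x w) xs) ≈ ∑ (λ x → ∑Arr n L (F x)) xs
  ∑Arr-∑ n L []       F = ∑Arr-zero n L
  ∑Arr-∑ n L (x ∷ xs) F = trans (∑Arr-+ n L _ _) (+-congˡ (∑Arr-∑ n L xs F))

  picks-pointwise : {S : ℕ → ℕ → Set} {L L′ : List ℕ} → Pointwise S L L′ →
    Pointwise (λ { (a , T) (a′ , T′) → S a a′ × Pointwise S T T′ }) (picks L) (picks L′)
  picks-pointwise []       = []
  picks-pointwise (s ∷ ss) =
    (s , ss) ∷ PW.map⁺ _ _ (PW.map (λ { (sa , sT) → sa , s ∷ sT }) (picks-pointwise ss))

  ∑Arr-pointwise : ∀ n {S : ℕ → ℕ → Set} {L L′ f g} → Pointwise S L L′ →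
                   (∀ {w w′} → Pointwise S w w′ → f w ≈ g w′) → ∑Arr n L f ≈ ∑Arr n L′ g
  ∑Arr-pointwise zero    sL f≈g = f≈g []
  ∑Arr-pointwise (suc n) sL f≈g = ∑-pointwise (picks-pointwise sL) (λ { (sa , sT) →
    ∑Arr-pointwise n sT (λ sw → f≈g (sa ∷ sw)) })

  -- insertAt j M w inserts the letter M before the j-th letter of w (at the end if j ≥ |w|).
  insertAt : ℕ → ℕ → List ℕ → List ℕ
  insertAt zero    M w       = M ∷ w
  insertAt (suc j) M []      = M ∷ []
  insertAt (suc j) M (a ∷ w) = a ∷ insertAt j M w

  insertAt≡ : ∀ j M w → insertAt j M w ≡ take j w ++ M ∷ drop j w
  insertAt≡ zero    M w       = ≡.refl
  insertAt≡ (suc j) M []      = ≡.refl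
  insertAt≡ (suc j) M (a ∷ w) = ≡.cong (a ∷_) (insertAt≡ j M w)

  ∑Arr-insert : ∀ n M L f → length L ≡ n →
                ∑Arr (suc n) (M ∷ L) f ≈ Σ< (suc n) (λ j → ∑Arr n L (f ∘ insertAt j M))
  ∑Arr-insert zero    M [] f eq = refl
  ∑Arr-insert (suc m) M L  f eq = begin
    ∑Arr (suc (suc m)) (M ∷ L) f
      ≈⟨ +-congˡ (∑-map _ _ (picks L)) ⟩
    ∑Arr (suc m) L (f ∘ (M ∷_)) + ∑ (λ { (a , S) → ∑Arr (suc m) (M ∷ S) (f ∘ (a ∷_)) }) (picks L)
      ≈⟨ +-congˡ (∑-congᴬ (picks-length m L eq) (λ { (a , S) lenS → ∑Arr-insert m M S (f ∘ (a ∷_)) lenS })) ⟩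
    ∑Arr (suc m) L (f ∘ (M ∷_))
      + ∑ (λ { (a , S) → Σ< (suc m) (λ j → ∑Arr m S (λ w → f (a ∷ insertAt j M w))) }) (picks L)
      ≈⟨ +-congˡ (∑-swap _ (picks L) (upTo (suc m))) ⟩
    ∑Arr (suc m) L (f ∘ (M ∷_)) + Σ< (suc m) (λ j → ∑Arr (suc m) L (f ∘ insertAt (suc j) M))
      ≈⟨ sym (Σ<-suc (suc m) _) ⟩
    Σ< (suc (suc m)) (λ j → ∑Arr (suc m) L (f ∘ insertAt j M)) ∎

  takeHead skipHead : ℕ → List ℕ × List ℕ → List ℕ × List ℕ
  takeHead x (S , S′) = x ∷ S , S′
  skipHead x (S , S′) = S , x ∷ S′

  splits : ℕ → List ℕ → List (List ℕ × List ℕ)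
  splits zero    L       = ([] , L) ∷ []
  splits (suc k) []      = []
  splits (suc k) (x ∷ L) = map (takeHead x) (splits k L) ++ map (skipHead x) (splits (suc k) L)

  splits-empty : ∀ k L → length L < k → splits k L ≡ []
  splits-empty (suc k) []      _         = ≡.refl
  splits-empty (suc k) (x ∷ L) (s≤s |L|<k) =
    ≡.cong₂ (λ a b → map (takeHead x) a ++ map (skipHead x) b) (splits-empty k L |L|<k) (splits-empty (suc k) L (ℕP.m<n⇒m<1+n |L|<k))

  splits-lengths : ∀ k L → All (λ { (S , S′) → length S ≡ k × length S′ ℕ.+ k ≡ length L }) (splits k L)
  splits-lengths zero    L       = (≡.refl , ℕP.+-identityʳ _) ∷ []
  splits-lengths (suc k) []      = []
  splits-lengths (suc k) (x ∷ L) = AllP.++⁺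
    (AllP.map⁺ (All.map (λ { (eS , eS′) → ≡.cong suc eS , ≡.trans (ℕP.+-suc _ _) (≡.cong suc eS′) }) (splits-lengths k L)))
    (AllP.map⁺ (All.map (λ { (eS , eS′) → eS , ≡.cong suc eS′ }) (splits-lengths (suc k) L)))

  splits-All : ∀ {P : ℕ → Set} k {L} → All P L → All (λ { (S , S′) → All P S × All P S′ }) (splits k L)
  splits-All zero    pL         = ([] , pL) ∷ []
  splits-All (suc k) []         = []
  splits-All (suc k) (px ∷ pxs) = AllP.++⁺
    (AllP.map⁺ (All.map (λ { (pS , pS′) → px ∷ pS , pS′ }) (splits-All k pxs)))
    (AllP.map⁺ (All.map (λ { (pS , pS′) → pS , px ∷ pS′ }) (splits-All (suc k) pxs)))

  splits-count : ∀ k L → length (splits k L) ≡ length L C k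
  splits-count zero    L       = ≡.refl
  splits-count (suc k) []      = ≡.refl
  splits-count (suc k) (x ∷ L) = ≡.trans (LP.length-++ (map (takeHead x) (splits k L)))
    (≡.trans (≡.cong₂ ℕ._+_ (≡.trans (LP.length-map (takeHead x) (splits k L)) (splits-count k L))
                            (≡.trans (LP.length-map (skipHead x) (splits (suc k) L)) (splits-count (suc k) L)))
             (nCk+nC[k+1]≡[n+1]C[k+1] (length L) k))

  length-take : ∀ j (π : List ℕ) m → j ≤ m → length π ≡ m → length (take j π) ≡ j
  length-take j π m j≤m eq = ≡.trans (LP.length-take j π) (≡.trans (≡.cong (j ℕ.⊓_) eq) (ℕP.m≤n⇒m⊓n≡m j≤m))

  take-insertAt : ∀ j k x π → j ≤ k → take (suc k) (insertAt j x π) ≡ insertAt j x (take k π)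
  take-insertAt zero    k       x π       _         = ≡.refl
  take-insertAt (suc j) (suc k) x []      _         = ≡.refl
  take-insertAt (suc j) (suc k) x (a ∷ π) (s≤s j≤k) = ≡.cong (a ∷_) (take-insertAt j k x π j≤k)

  drop-insertAt : ∀ j k x π → j ≤ k → drop (suc k) (insertAt j x π) ≡ drop k π
  drop-insertAt zero    k       x π       _         = ≡.refl
  drop-insertAt (suc j) (suc k) x []      _         = ≡.refl
  drop-insertAt (suc j) (suc k) x (a ∷ π) (s≤s j≤k) = drop-insertAt j k x π j≤k

  take-insertAt-right : ∀ k j x π → k ≤ length π → take k (insertAt (k ℕ.+ j) x π) ≡ take k π
  take-insertAt-right zero    j x π       _         = ≡.refl
  take-insertAt-right (suc k) j x (a ∷ π) (s≤s k≤π) = ≡.cong (a ∷_) (take-insertAt-right k j x π k≤π)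

  drop-insertAt-right : ∀ k j x π → k ≤ length π → drop k (insertAt (k ℕ.+ j) x π) ≡ insertAt j x (drop k π)
  drop-insertAt-right zero    j x π       _         = ≡.refl
  drop-insertAt-right (suc k) j x (a ∷ π) (s≤s k≤π) = drop-insertAt-right k j x π k≤π

  ∑Splits : ℕ → ℕ → List (List ℕ × List ℕ) → (G H : List ℕ → Carrier) → Carrier
  ∑Splits k r Ss G H = ∑ (λ { (S , S′) → ∑Arr k S G * ∑Arr r S′ H }) Ss

  Shuffle : List ℕ → Set (c ⊔ ℓ)
  Shuffle L = ∀ k r (G H : List ℕ → Carrier) → length L ≡ k ℕ.+ r →
    ∑Arr (length L) L (λ π → G (take k π) * H (drop k π)) ≈ ∑Splits k r (splits k L) G H

  -- Inserting x into the prefix: the splits of x ∷ L in which x is chosen.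
  shuffle-headChosen : ∀ {x L} → Shuffle L → ∀ k r G H → length L ≡ k ℕ.+ r →
    Σ< (suc k) (λ j → ∑Arr (length L) L (λ π → G (take (suc k) (insertAt j x π)) * H (drop (suc k) (insertAt j x π))))
      ≈ ∑Splits (suc k) r (map (takeHead x) (splits k L)) G H
  shuffle-headChosen {x} {L} shuffleL k r G H eq = begin
    Σ< (suc k) (λ j → ∑Arr n L (λ π → G (take (suc k) (insertAt j x π)) * H (drop (suc k) (insertAt j x π))))
      ≈⟨ Σ<-cong (suc k) (λ j j<1+k → ∑Arr-cong n (λ π → reflexive (≡.cong₂ (λ a b → G a * H b)
           (take-insertAt j k x π (ℕP.≤-pred j<1+k)) (drop-insertAt j k x π (ℕP.≤-pred j<1+k))))) ⟩
    Σ< (suc k) (λ j → ∑Arr n L (λ π → G (insertAt j x (take k π)) * H (drop k π)))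
      ≈⟨ sym (∑Arr-∑ n L (upTo (suc k)) _) ⟩
    ∑Arr n L (λ π → Σ< (suc k) (λ j → G (insertAt j x (take k π)) * H (drop k π)))
      ≈⟨ ∑Arr-cong n (λ π → sym (∑-*ʳ _ _ (upTo (suc k)))) ⟩
    ∑Arr n L (λ π → G′ (take k π) * H (drop k π))
      ≈⟨ shuffleL k r G′ H eq ⟩
    ∑Splits k r (splits k L) G′ H
      ≈⟨ ∑-congᴬ (splits-lengths k L) (λ { (S , S′) (lenS , _) →
           *-congʳ (trans (∑Arr-∑ k S (upTo (suc k)) _) (sym (∑Arr-insert k x S G lenS))) }) ⟩
    ∑ (λ { (S , S′) → ∑Arr (suc k) (x ∷ S) G * ∑Arr r S′ H }) (splits k L)
      ≈⟨ sym (∑-map _ (takeHead x) (splits k L)) ⟩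
    ∑Splits (suc k) r (map (takeHead x) (splits k L)) G H ∎
    where
    n = length L
    G′ : List ℕ → Carrier
    G′ σ = Σ< (suc k) (λ j → G (insertAt j x σ))

  -- Inserting x into the suffix: the splits of x ∷ L in which x is not chosen.
  shuffle-headSkipped : ∀ {x L} → Shuffle L → ∀ k r G H → length L ≡ suc k ℕ.+ r →
    Σ< (suc r) (λ j → ∑Arr (length L) L (λ π →
        G (take (suc k) (insertAt (suc k ℕ.+ j) x π)) * H (drop (suc k) (insertAt (suc k ℕ.+ j) x π))))
      ≈ ∑Splits (suc k) (suc r) (map (skipHead x) (splits (suc k) L)) G H
  shuffle-headSkipped {x} {L} shuffleL k r G H eq = begin
    Σ< (suc r) (λ j → ∑Arr n L (λ π →
        G (take (suc k) (insertAt (suc k ℕ.+ j) x π)) * H (drop (suc k) (insertAt (suc k ℕ.+ j) x π))))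
      ≈⟨ ∑-cong (upTo (suc r)) (λ j → ∑Arr-congˡ n (λ π lenπ → reflexive (≡.cong₂ (λ a b → G a * H b)
           (take-insertAt-right (suc k) j x π (cutFits π lenπ)) (drop-insertAt-right (suc k) j x π (cutFits π lenπ))))) ⟩
    Σ< (suc r) (λ j → ∑Arr n L (λ π → G (take (suc k) π) * H (insertAt j x (drop (suc k) π))))
      ≈⟨ sym (∑Arr-∑ n L (upTo (suc r)) _) ⟩
    ∑Arr n L (λ π → Σ< (suc r) (λ j → G (take (suc k) π) * H (insertAt j x (drop (suc k) π))))
      ≈⟨ ∑Arr-cong n (λ π → sym (∑-*ˡ _ _ (upTo (suc r)))) ⟩
    ∑Arr n L (λ π → G (take (suc k) π) * H′ (drop (suc k) π))
      ≈⟨ shuffleL (suc k) r G H′ eq ⟩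
    ∑Splits (suc k) r (splits (suc k) L) G H′
      ≈⟨ ∑-congᴬ (splits-lengths (suc k) L) (λ { (S , S′) (_ , lenS′) →
           *-congˡ (trans (∑Arr-∑ r S′ (upTo (suc r)) _) (sym (∑Arr-insert r x S′ H (restLength S′ lenS′)))) }) ⟩
    ∑ (λ { (S , S′) → ∑Arr (suc k) S G * ∑Arr (suc r) (x ∷ S′) H }) (splits (suc k) L)
      ≈⟨ sym (∑-map _ (skipHead x) (splits (suc k) L)) ⟩
    ∑Splits (suc k) (suc r) (map (skipHead x) (splits (suc k) L)) G H ∎
    where
    n = length L
    H′ : List ℕ → Carrier
    H′ τ = Σ< (suc r) (λ j → H (insertAt j x τ))
    cutFits : ∀ π → length π ≡ n → suc k ≤ length π
    cutFits π lenπ = ℕP.≤-trans (ℕP.m≤m+n (suc k) r) (ℕP.≤-reflexive (≡.sym (≡.trans lenπ eq)))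
    restLength : ∀ S′ → length S′ ℕ.+ suc k ≡ n → length S′ ≡ r
    restLength S′ lenS′ = ℕP.+-cancelʳ-≡ (suc k) _ _ (≡.trans lenS′ (≡.trans eq (ℕP.+-comm (suc k) r)))

  shuffle : ∀ L → Shuffle L
  shuffle L zero r G H eq = begin
    ∑Arr (length L) L (λ π → G [] * H π)  ≈⟨ ∑Arr-*ˡ (length L) L (G []) H ⟩
    G [] * ∑Arr (length L) L H            ≡⟨ ≡.cong (λ n → G [] * ∑Arr n L H) eq ⟩
    G [] * ∑Arr r L H                     ≈⟨ sym (+-identityʳ _) ⟩
    ∑Splits zero r (splits zero L) G H    ∎
  shuffle (x ∷ L) (suc k) r G H eq = begin
    ∑Arr (suc n) (x ∷ L) F                                     ≈⟨ ∑Arr-insert n x L F ≡.refl ⟩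
    Σ< (suc n) (λ j → ∑Arr n L (F ∘ insertAt j x))             ≡⟨ ≡.cong (λ m → Σ< (suc m) (λ j → ∑Arr n L (F ∘ insertAt j x))) eqL ⟩
    Σ< (suc k ℕ.+ r) (λ j → ∑Arr n L (F ∘ insertAt j x))       ≈⟨ Σ<-split (suc k) r _ ⟩
    Σ< (suc k) (λ j → ∑Arr n L (F ∘ insertAt j x))
      + Σ< r (λ j → ∑Arr n L (F ∘ insertAt (suc k ℕ.+ j) x))   ≈⟨ +-cong (shuffle-headChosen (shuffle L) k r G H eqL) (headSkipped r eqL) ⟩
    ∑Splits (suc k) r (map (takeHead x) (splits k L)) G H
      + ∑Splits (suc k) r (map (skipHead x) (splits (suc k) L)) G H ≈⟨ sym (∑-++ _ (map (takeHead x) (splits k L)) _) ⟩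
    ∑Splits (suc k) r (splits (suc k) (x ∷ L)) G H             ∎
    where
    n = length L
    eqL : n ≡ k ℕ.+ r
    eqL = ≡.cong ℕ.pred eq
    F : List ℕ → Carrier
    F π = G (take (suc k) π) * H (drop (suc k) π)
    headSkipped : ∀ r → n ≡ k ℕ.+ r →
      Σ< r (λ j → ∑Arr n L (F ∘ insertAt (suc k ℕ.+ j) x)) ≈ ∑Splits (suc k) r (map (skipHead x) (splits (suc k) L)) G H
    headSkipped zero    eqL = reflexive (≡.cong (λ Ss → ∑Splits (suc k) zero (map (skipHead x) Ss) G H)
      (≡.sym (splits-empty (suc k) L (s≤s (ℕP.≤-reflexive (≡.trans eqL (ℕP.+-identityʳ k)))))))
    headSkipped (suc r) eqL = shuffle-headSkipped (shuffle L) k r G H (≡.trans eqL (ℕP.+-suc k r))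

  -- Strict orders on letters: increasing (d = false) or decreasing (d = true).
  Ordered : Bool → ℕ → ℕ → Set
  Ordered false x y = x < y
  Ordered true  x y = y < x

  StrictlySorted : Bool → List ℕ → Set
  StrictlySorted d = AllPairs (Ordered d)

  compare-Ordered : ∀ d {x y} → Ordered d x y → (y <ᵇ x) ≡ d
  compare-Ordered false x<y = dec-false (_ <? _) (ℕP.<⇒≯ x<y)
  compare-Ordered true  y<x = dec-true (_ <? _) y<x

  compare-Ordered′ : ∀ d {x y} → Ordered d x y → (x <ᵇ y) ≡ not d
  compare-Ordered′ false x<y = dec-true (_ <? _) x<y
  compare-Ordered′ true  y<x = dec-false (_ <? _) (ℕP.<⇒≯ y<x)

  Ordered⇒≢ : ∀ d {x y} → Ordered d x y → x ≢ y
  Ordered⇒≢ false x<y x≡y = ℕP.<-irrefl x≡y x<y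
  Ordered⇒≢ true  y<x x≡y = ℕP.<-irrefl (≡.sym x≡y) y<x

  sorted⇒unique : ∀ {d L} → StrictlySorted d L → Unique L
  sorted⇒unique = AllPairs.map (Ordered⇒≢ _)

  up-sorted : ∀ n → StrictlySorted false (applyUpTo suc n)
  up-sorted n = AllPairsP.applyUpTo⁺₁ suc n (λ i<j _ → s≤s i<j)

  down-sorted : ∀ n → StrictlySorted true (applyDownFrom suc n)
  down-sorted n = AllPairsP.applyDownFrom⁺₁ suc n (λ j<i _ → s≤s j<i)

  up↭down : ∀ n → applyUpTo suc n ↭ applyDownFrom suc n
  up↭down n = ≡.subst (applyUpTo suc n ↭_) (LP.reverse-applyUpTo suc n) (Perm.↭-sym (PermP.↭-reverse (applyUpTo suc n)))

  splits-sorted : ∀ {d L} → StrictlySorted d L → ∀ k → All (λ { (S , S′) → StrictlySorted d S × StrictlySorted d S′ }) (splits k L)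
  splits-sorted sL          zero    = ([] , sL) ∷ []
  splits-sorted []          (suc k) = []
  splits-sorted (xL ∷ sL)   (suc k) = AllP.++⁺
    (AllP.map⁺ (All.zipWith (λ { ((sS , sS′) , (xS , _)) → xS ∷ sS , sS′ }) (splits-sorted sL k , splits-All k xL)))
    (AllP.map⁺ (All.zipWith (λ { ((sS , sS′) , (_ , xS′)) → sS , xS′ ∷ sS′ }) (splits-sorted sL (suc k) , splits-All (suc k) xL)))

  SamePosition : List ℕ → List ℕ → ℕ → ℕ → Set
  SamePosition (x ∷ L) (x′ ∷ L′) a a′ = (a ≡ x × a′ ≡ x′) ⊎ SamePosition L L′ a a′
  SamePosition _       _         a a′ = ⊥

  samePosition-pointwise : ∀ L L′ → length L ≡ length L′ → Pointwise (SamePosition L L′) L L′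
  samePosition-pointwise []      []        _  = []
  samePosition-pointwise (x ∷ L) (x′ ∷ L′) eq =
    inj₁ (≡.refl , ≡.refl) ∷ PW.map inj₂ (samePosition-pointwise L L′ (≡.cong ℕ.pred eq))

  samePosition-All : ∀ {P Q : ℕ → Set} L L′ {a a′} → SamePosition L L′ a a′ → All P L → All Q L′ → P a × Q a′
  samePosition-All (x ∷ L) (x′ ∷ L′) (inj₁ (≡.refl , ≡.refl)) (px ∷ _)   (qx ∷ _)   = px , qx
  samePosition-All (x ∷ L) (x′ ∷ L′) (inj₂ same)              (_ ∷ pxs) (_ ∷ qxs) = samePosition-All L L′ same pxs qxs

  samePosition-compare : ∀ {d} L L′ → StrictlySorted d L → StrictlySorted d L′ →
    ∀ {a a′ c c′} → SamePosition L L′ a a′ → SamePosition L L′ c c′ → (c <ᵇ a) ≡ (c′ <ᵇ a′)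
  samePosition-compare (x ∷ L) (x′ ∷ L′) _ _ (inj₁ (≡.refl , ≡.refl)) (inj₁ (≡.refl , ≡.refl)) =
    ≡.trans (dec-false (x <? x) (ℕP.<-irrefl ≡.refl)) (≡.sym (dec-false (x′ <? x′) (ℕP.<-irrefl ≡.refl)))
  samePosition-compare {d} (x ∷ L) (x′ ∷ L′) (xL ∷ _) (xL′ ∷ _) (inj₁ (≡.refl , ≡.refl)) (inj₂ same) =
    let (xc , xc′) = samePosition-All L L′ same xL xL′ in
    ≡.trans (compare-Ordered d xc) (≡.sym (compare-Ordered d xc′))
  samePosition-compare {d} (x ∷ L) (x′ ∷ L′) (xL ∷ _) (xL′ ∷ _) (inj₂ same) (inj₁ (≡.refl , ≡.refl)) =
    let (xa , xa′) = samePosition-All L L′ same xL xL′ in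
    ≡.trans (compare-Ordered′ d xa) (≡.sym (compare-Ordered′ d xa′))
  samePosition-compare (x ∷ L) (x′ ∷ L′) (_ ∷ sL) (_ ∷ sL′) (inj₂ same) (inj₂ same′) =
    samePosition-compare L L′ sL sL′ same same′

  desWeight-swap : ∀ p q b w → desWeight R p q (not b) w ≡ desWeight R q p b w
  desWeight-swap p q b     []            = ≡.refl
  desWeight-swap p q b     (x ∷ [])      = ≡.refl
  desWeight-swap p q true  (x ∷ y ∷ w) = ≡.cong ((if y <ᵇ x then q else 1#) *_) (desWeight-swap p q false (y ∷ w))
  desWeight-swap p q false (x ∷ y ∷ w) = ≡.cong ((if y <ᵇ x then p else 1#) *_) (desWeight-swap p q true (y ∷ w))

  desWeight-pointwise : ∀ p q {S : ℕ → ℕ → Set} → (∀ {a a′ c c′} → S a a′ → S c c′ → (c <ᵇ a) ≡ (c′ <ᵇ a′)) →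
                        ∀ b {w w′} → Pointwise S w w′ → desWeight R p q b w ≡ desWeight R p q b w′
  desWeight-pointwise p q cmp b []               = ≡.refl
  desWeight-pointwise p q cmp b (s ∷ [])         = ≡.refl
  desWeight-pointwise p q cmp b (s ∷ s′ ∷ ss) =
    ≡.cong₂ _*_ (≡.cong (λ z → if z then (if b then p else q) else 1#) (cmp s s′)) (desWeight-pointwise p q cmp (not b) (s′ ∷ ss))

  A≈∑Arr : ∀ p q n → A R n p q ≈ ∑Arr n (applyUpTo suc n) (desWeight R p q true)
  A≈∑Arr p q n = begin
    A R n p q                                                           ≈⟨ ∑-filter unique? _ (words n n) ⟩
    ∑ (λ w → guard (distinct w) (desWeight R p q true w)) (words n n)   ≡⟨ ≡.cong (∑ _) (words≡wordsOver n n) ⟩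
    ∑Distinct n (applyUpTo suc n) (desWeight R p q true)
      ≈⟨ ∑Distinct≈∑Arr n _ _ (sorted⇒unique {false} (up-sorted n)) (LP.length-applyUpTo suc n) ⟩
    ∑Arr n (applyUpTo suc n) (desWeight R p q true) ∎

  -- Inserting a new letter M into the arrangements of a sorted alphabet L of size m: if
  -- the weight of "π with M inserted at place j" factors through the two sides of M, and
  -- the two factors have total v j whichever j letters go to the left, then the total is
  -- the binomial convolution Σ_j C(m, j) v j.
  insertionFormula : ∀ {d} m M L (P : ℕ → Set) (f : List ℕ → Carrier) (G H : ℕ → List ℕ → Carrier) (v : ℕ → Carrier) →
    length L ≡ m → StrictlySorted d L → All P L →
    (∀ j π → j ≤ m → length π ≡ m → All P π → f (insertAt j M π) ≈ G j (take j π) * H j (drop j π)) →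
    (∀ j S S′ → j ≤ m → length S ≡ j → length S′ ≡ m ∸ j →
       StrictlySorted d S → All P S → StrictlySorted d S′ → All P S′ → ∑Arr j S (G j) * ∑Arr (m ∸ j) S′ (H j) ≈ v j) →
    ∑Arr (suc m) (M ∷ L) f ≈ Σ< (suc m) (λ j → fromℕ R (m C j) * v j)
  insertionFormula {d} m M L P f G H v ≡.refl sL pL factor total = begin
    ∑Arr (suc m) (M ∷ L) f                            ≈⟨ ∑Arr-insert m M L f ≡.refl ⟩
    Σ< (suc m) (λ j → ∑Arr m L (f ∘ insertAt j M))    ≈⟨ Σ<-cong (suc m) (λ j j<1+m → term j (ℕP.≤-pred j<1+m)) ⟩
    Σ< (suc m) (λ j → fromℕ R (m C j) * v j)          ∎
    where
    term : ∀ j → j ≤ m → ∑Arr m L (f ∘ insertAt j M) ≈ fromℕ R (m C j) * v j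
    term j j≤m = begin
      ∑Arr m L (f ∘ insertAt j M)
        ≈⟨ ∑Arr-congᴬ m pL (λ π lenπ pπ → factor j π j≤m lenπ pπ) ⟩
      ∑Arr m L (λ π → G j (take j π) * H j (drop j π))
        ≈⟨ shuffle L j (m ∸ j) (G j) (H j) (≡.sym (ℕP.m+[n∸m]≡n j≤m)) ⟩
      ∑Splits j (m ∸ j) (splits j L) (G j) (H j)
        ≈⟨ ∑-congᴬ (All.zip (splits-sorted {d} sL j , All.zip (splits-All j pL , splits-lengths j L)))
             (λ { (S , S′) ((sS , sS′) , (pS , pS′) , (lenS , lenS′)) → total j S S′ j≤m lenS (restLength {S′} lenS′) sS pS sS′ pS′ }) ⟩
      ∑ (λ _ → v j) (splits j L)                    ≈⟨ ∑-const (v j) (splits j L) ⟩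
      fromℕ R (length (splits j L)) * v j           ≡⟨ ≡.cong (λ z → fromℕ R z * v j) (splits-count j L) ⟩
      fromℕ R (m C j) * v j                         ∎
      where
      restLength : ∀ {S′ : List ℕ} → length S′ ℕ.+ j ≡ m → length S′ ≡ m ∸ j
      restLength {S′} eq = ≡.trans (≡.sym (ℕP.m+n∸n≡m (length S′) j)) (≡.cong (_∸ j) eq)

  binomial-reflect : ∀ m j (F G : ℕ → Carrier) → j ≤ m →
    fromℕ R (m C (m ∸ j)) * F (m ∸ j) * G (m ∸ (m ∸ j)) ≈ fromℕ R (m C j) * G j * F (m ∸ j)
  binomial-reflect m j F G j≤m = begin
    fromℕ R (m C (m ∸ j)) * F (m ∸ j) * G (m ∸ (m ∸ j))
      ≡⟨ ≡.cong₂ (λ b i → fromℕ R b * F (m ∸ j) * G i) (≡.sym (nCk≡nC[n∸k] j≤m)) (ℕP.m∸[m∸n]≡n j≤m) ⟩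
    fromℕ R (m C j) * F (m ∸ j) * G j   ≈⟨ *-assoc _ _ _ ⟩
    fromℕ R (m C j) * (F (m ∸ j) * G j) ≈⟨ *-congˡ (*-comm _ _) ⟩
    fromℕ R (m C j) * (G j * F (m ∸ j)) ≈⟨ sym (*-assoc _ _ _) ⟩
    fromℕ R (m C j) * G j * F (m ∸ j)   ∎

  C-diagonal : ∀ n → fromℕ R (n C n) ≈ 1#
  C-diagonal n = trans (reflexive (≡.cong (fromℕ R) (nCn≡1 n))) (+-identityʳ 1#)

  m∸n≡suc[m∸suc[n]] : ∀ {m n} → n < m → m ∸ n ≡ suc (m ∸ suc n)
  m∸n≡suc[m∸suc[n]] {suc m} {zero}  _         = ≡.refl
  m∸n≡suc[m∸suc[n]] {suc m} {suc n} (s≤s n<m) = m∸n≡suc[m∸suc[n]] n<m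

  odd<even : ∀ {k i} → i < k → suc (2 ℕ.* i) < 2 ℕ.* k
  odd<even {k} {i} i<k = ≡.subst (_≤ 2 ℕ.* k) (ℕP.*-suc 2 i) (ℕP.*-monoʳ-≤ 2 i<k)

  odd-complement : ∀ k i → i < k → 2 ℕ.* k ∸ suc (2 ℕ.* i) ≡ suc (2 ℕ.* (k ∸ suc i))
  odd-complement k i i<k = ≡.trans (m∸n≡suc[m∸suc[n]] (odd<even i<k))
    (≡.cong suc (≡.trans (≡.cong (2 ℕ.* k ∸_) (≡.sym (ℕP.*-suc 2 i))) (≡.sym (ℕP.*-distribˡ-∸ 2 k (suc i)))))

  module Rearrange where
    open import Algebra.Solver.Ring.NaturalCoefficients.Default R using (solve; _:+_; _:*_; _:=_; con)

    pull-right : ∀ c x w y → c * (x * (w * y)) ≈ w * ((c * x) * y)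
    pull-right = solve 4 (λ c x w y → c :* (x :* (w :* y)) := w :* ((c :* x) :* y)) refl

    pull-middle : ∀ c x w y → c * ((x * w) * y) ≈ w * ((c * x) * y)
    pull-middle = solve 4 (λ c x w y → c :* ((x :* w) :* y) := w :* ((c :* x) :* y)) refl

    last-to-front : ∀ x y a → (x + y) + a ≈ a + x + y
    last-to-front = solve 3 (λ x y a → (x :+ y) :+ a := a :+ x :+ y) refl

    swap-summands : ∀ a x y → a + x + y ≈ a + y + x
    swap-summands = solve 3 (λ a x y → a :+ x :+ y := a :+ y :+ x) refl

    collect : ∀ p q X a → p * (X + a) + (q * X + a) ≈ (1# + p) * a + (p + q) * X
    collect = solve 4 (λ p q X a → p :* (X :+ a) :+ (q :* X :+ a) := (con 1 :+ p) :* a :+ (p :+ q) :* X) refl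

  -- shift j b is the parity flag of index j + 1 when index 1 has flag b.
  shift : ℕ → Bool → Bool
  shift zero    b = b
  shift (suc j) b = shift j (not b)

  shift-even : ∀ i b → shift (2 ℕ.* i) b ≡ b
  shift-even zero    b = ≡.refl
  shift-even (suc i) b = ≡.trans (≡.cong (λ j → shift j b) (ℕP.*-suc 2 i))
                        (≡.trans (≡.cong (shift (2 ℕ.* i)) (not-involutive b)) (shift-even i b))

  module Weighted (p q : Carrier) where

    D : Bool → List ℕ → Carrier
    D = desWeight R p q

    wt : Bool → Carrier
    wt b = if b then p else q

    Aᵇ : Bool → ℕ → Carrier
    Aᵇ true  n = A R n p q
    Aᵇ false n = A R n q p

    Aᵇ≈∑Arr-up : ∀ b n → Aᵇ b n ≈ ∑Arr n (applyUpTo suc n) (D b)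
    Aᵇ≈∑Arr-up true  n = A≈∑Arr p q n
    Aᵇ≈∑Arr-up false n = trans (A≈∑Arr q p n) (∑Arr-cong n (λ w → reflexive (≡.sym (desWeight-swap p q true w))))

    Aᵇ≈∑Arr-down : ∀ b n → Aᵇ b n ≈ ∑Arr n (applyDownFrom suc n) (D b)
    Aᵇ≈∑Arr-down b n = begin
      Aᵇ b n                                  ≈⟨ Aᵇ≈∑Arr-up b n ⟩
      ∑Arr n (applyUpTo suc n) (D b)          ≈⟨ sym (∑Distinct≈∑Arr n _ _ (sorted⇒unique {false} (up-sorted n)) (LP.length-applyUpTo suc n)) ⟩
      ∑Distinct n (applyUpTo suc n) (D b)     ≈⟨ ∑-wordsOver-↭ n (up↭down n) _ ⟩
      ∑Distinct n (applyDownFrom suc n) (D b) ≈⟨ ∑Distinct≈∑Arr n _ _ (sorted⇒unique {true} (down-sorted n)) (LP.length-applyDownFrom suc n) ⟩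
      ∑Arr n (applyDownFrom suc n) (D b)      ∎

    relabel : ∀ {d} n L L′ b → StrictlySorted d L → StrictlySorted d L′ → length L ≡ length L′ →
              ∑Arr n L (D b) ≈ ∑Arr n L′ (D b)
    relabel n L L′ b sL sL′ eq = ∑Arr-pointwise n (samePosition-pointwise L L′ eq)
      (λ sw → reflexive (desWeight-pointwise p q (samePosition-compare L L′ sL sL′) b sw))

    ∑Arr-sorted : ∀ d b n S → StrictlySorted d S → length S ≡ n → ∑Arr n S (D b) ≈ Aᵇ b n
    ∑Arr-sorted true  b n S sS eq = trans (relabel {true} n S (applyDownFrom suc n) b sS (down-sorted n)
      (≡.trans eq (≡.sym (LP.length-applyDownFrom suc n)))) (sym (Aᵇ≈∑Arr-down b n))
    ∑Arr-sorted false b n S sS eq = trans (relabel {false} n S (applyUpTo suc n) b sS (up-sorted n)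
      (≡.trans eq (≡.sym (LP.length-applyUpTo suc n)))) (sym (Aᵇ≈∑Arr-up b n))

    D-++ : ∀ b σ x τ → D b (σ ++ x ∷ τ) ≈ D b (σ ++ x ∷ []) * D (shift (length σ) b) (x ∷ τ)
    D-++ b []           x τ = sym (*-identityˡ _)
    D-++ b (s ∷ [])     x τ = *-congʳ (sym (*-identityʳ _))
    D-++ b (s ∷ s′ ∷ σ) x τ = trans (*-congˡ (D-++ (not b) (s′ ∷ σ) x τ)) (sym (*-assoc _ _ _))

    D-maxLast : ∀ b σ x → All (_< x) σ → D b (σ ++ x ∷ []) ≈ D b σ
    D-maxLast b []           x []           = refl
    D-maxLast b (s ∷ [])     x (s<x ∷ [])   rewrite dec-false (x <? s) (ℕP.<⇒≯ s<x) = *-identityˡ _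
    D-maxLast b (s ∷ s′ ∷ σ) x (_ ∷ σ<x)    = *-congˡ (D-maxLast (not b) (s′ ∷ σ) x σ<x)

    D-maxFirst : ∀ b x t τ → t < x → D b (x ∷ t ∷ τ) ≈ wt b * D (not b) (t ∷ τ)
    D-maxFirst b x t τ t<x rewrite dec-true (t <? x) t<x = refl

    D-minFirst : ∀ b x τ → All (x <_) τ → D b (x ∷ τ) ≈ D (not b) τ
    D-minFirst b x []      _           = refl
    D-minFirst b x (t ∷ τ) (x<t ∷ _) rewrite dec-false (t <? x) (ℕP.<⇒≯ x<t) = *-identityˡ _

    D-minLast : ∀ b s σ x → All (x <_) (s ∷ σ) → D b (s ∷ σ ++ x ∷ []) ≈ D b (s ∷ σ) * wt (shift (length σ) b)
    D-minLast b s []       x (x<s ∷ []) rewrite dec-true (x <? s) x<s = trans (*-identityʳ _) (sym (*-identityˡ _))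
    D-minLast b s (s′ ∷ σ) x (_ ∷ x<σ)   = trans (*-congˡ (D-minLast (not b) s′ σ x x<σ)) (sym (*-assoc _ _ _))

    -- Inserting the maximum m + 1 at place j + 1 of a permutation of [m]: the letters
    -- after it (r of them) carry a descent at the maximum and start at index j + 2.
    rightOfMax : ℕ → ℕ → Carrier
    rightOfMax j zero    = 1#
    rightOfMax j (suc r) = wt (shift j true) * Aᵇ (not (shift j true)) (suc r)

    maxTerm : ℕ → ℕ → Carrier
    maxTerm m j = fromℕ R (m C j) * (A R j p q * rightOfMax j (m ∸ j))

    -- A_{m+1} = Σ_j C(m, j) A_j · rightOfMax j (m - j), choosing which j letters precede m + 1.
    maxInsertion : ∀ m → A R (suc m) p q ≈ Σ< (suc m) (maxTerm m)
    maxInsertion m = trans (Aᵇ≈∑Arr-down true (suc m))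
      (insertionFormula {true} m (suc m) (applyDownFrom suc m) (_< suc m) (D true) (λ _ → D true)
        (λ j τ → D (shift j true) (suc m ∷ τ)) (λ j → A R j p q * rightOfMax j (m ∸ j))
        (LP.length-applyDownFrom suc m) (down-sorted m) (AllP.applyDownFrom⁺₁ suc m s≤s) factor total)
      where
      factor : ∀ j π → j ≤ m → length π ≡ m → All (_< suc m) π →
               D true (insertAt j (suc m) π) ≈ D true (take j π) * D (shift j true) (suc m ∷ drop j π)
      factor j π j≤m lenπ π<M = begin
        D true (insertAt j (suc m) π)             ≡⟨ ≡.cong (D true) (insertAt≡ j (suc m) π) ⟩
        D true (take j π ++ suc m ∷ drop j π)     ≈⟨ D-++ true (take j π) (suc m) (drop j π) ⟩
        D true (take j π ++ suc m ∷ []) * D (shift (length (take j π)) true) (suc m ∷ drop j π)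
          ≈⟨ *-cong (D-maxLast true (take j π) (suc m) (AllP.take⁺ j π<M))
                    (reflexive (≡.cong (λ i → D (shift i true) (suc m ∷ drop j π)) (length-take j π m j≤m lenπ))) ⟩
        D true (take j π) * D (shift j true) (suc m ∷ drop j π) ∎
      rightTotal : ∀ j r S′ → length S′ ≡ r → StrictlySorted true S′ → All (_< suc m) S′ →
                   ∑Arr r S′ (λ τ → D (shift j true) (suc m ∷ τ)) ≈ rightOfMax j r
      rightTotal j zero    S′ _     _   _    = refl
      rightTotal j (suc r) S′ lenS′ sS′ S′<M = begin
        ∑Arr (suc r) S′ (λ τ → D b (suc m ∷ τ))    ≈⟨ ∑Arr-congᴬ (suc r) S′<M descentAtMax ⟩
        ∑Arr (suc r) S′ (λ τ → wt b * D (not b) τ) ≈⟨ ∑Arr-*ˡ (suc r) S′ (wt b) (D (not b)) ⟩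
        wt b * ∑Arr (suc r) S′ (D (not b))         ≈⟨ *-congˡ (∑Arr-sorted true (not b) (suc r) S′ sS′ lenS′) ⟩
        rightOfMax j (suc r)                       ∎
        where
        b = shift j true
        descentAtMax : ∀ τ → length τ ≡ suc r → All (_< suc m) τ → D b (suc m ∷ τ) ≈ wt b * D (not b) τ
        descentAtMax (t ∷ τ) _ (t<M ∷ _) = D-maxFirst b (suc m) t τ t<M
      total : ∀ j S S′ → j ≤ m → length S ≡ j → length S′ ≡ m ∸ j →
              StrictlySorted true S → All (_< suc m) S → StrictlySorted true S′ → All (_< suc m) S′ →
              ∑Arr j S (D true) * ∑Arr (m ∸ j) S′ (λ τ → D (shift j true) (suc m ∷ τ)) ≈ A R j p q * rightOfMax j (m ∸ j)
      total j S S′ _ lenS lenS′ sS _ sS′ S′<M =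
        *-cong (∑Arr-sorted true true j S sS lenS) (rightTotal j (m ∸ j) S′ lenS′ sS′ S′<M)

    -- Inserting the minimum 1 at place j + 1 of a permutation of 2, …, m + 1: the j letters
    -- before it carry a descent at index j, and the letters after it start at index j + 2.
    leftOfMin : ℕ → Carrier
    leftOfMin zero    = 1#
    leftOfMin (suc j) = A R (suc j) p q * wt (shift j true)

    minTerm : ℕ → ℕ → Carrier
    minTerm m j = fromℕ R (m C j) * (leftOfMin j * Aᵇ (not (shift j true)) (m ∸ j))

    -- A_{m+1} = Σ_j C(m, j) leftOfMin j · A_{m-j}, choosing which j letters precede 1.
    minInsertion : ∀ m → A R (suc m) p q ≈ Σ< (suc m) (minTerm m)
    minInsertion m = trans (Aᵇ≈∑Arr-up true (suc m))
      (insertionFormula {false} m 1 L (1 <_) (D true) (λ j σ → D true (σ ++ 1 ∷ [])) (λ j → D (not (shift j true)))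
        (λ j → leftOfMin j * Aᵇ (not (shift j true)) (m ∸ j))
        (LP.length-applyUpTo _ m) (AllPairs.tail (up-sorted (suc m))) (AllP.applyUpTo⁺₂ (suc ∘ suc) m (λ i → s≤s (s≤s z≤n)))
        factor total)
      where
      L : List ℕ
      L = applyUpTo (suc ∘ suc) m
      factor : ∀ j π → j ≤ m → length π ≡ m → All (1 <_) π →
               D true (insertAt j 1 π) ≈ D true (take j π ++ 1 ∷ []) * D (not (shift j true)) (drop j π)
      factor j π j≤m lenπ 1<π = begin
        D true (insertAt j 1 π)                   ≡⟨ ≡.cong (D true) (insertAt≡ j 1 π) ⟩
        D true (take j π ++ 1 ∷ drop j π)         ≈⟨ D-++ true (take j π) 1 (drop j π) ⟩
        D true (take j π ++ 1 ∷ []) * D (shift (length (take j π)) true) (1 ∷ drop j π)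
          ≈⟨ *-congˡ (trans (reflexive (≡.cong (λ i → D (shift i true) (1 ∷ drop j π)) (length-take j π m j≤m lenπ)))
                            (D-minFirst _ 1 (drop j π) (AllP.drop⁺ j 1<π))) ⟩
        D true (take j π ++ 1 ∷ []) * D (not (shift j true)) (drop j π) ∎
      leftTotal : ∀ j S → length S ≡ j → StrictlySorted false S → All (1 <_) S →
                  ∑Arr j S (λ σ → D true (σ ++ 1 ∷ [])) ≈ leftOfMin j
      leftTotal zero    S _    _  _   = refl
      leftTotal (suc j) S lenS sS 1<S = begin
        ∑Arr (suc j) S (λ σ → D true (σ ++ 1 ∷ []))   ≈⟨ ∑Arr-congᴬ (suc j) 1<S descentAtMin ⟩
        ∑Arr (suc j) S (λ σ → D true σ * wt b)        ≈⟨ ∑Arr-*ʳ (suc j) S (wt b) (D true) ⟩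
        ∑Arr (suc j) S (D true) * wt b                ≈⟨ *-congʳ (∑Arr-sorted false true (suc j) S sS lenS) ⟩
        leftOfMin (suc j)                             ∎
        where
        b = shift j true
        descentAtMin : ∀ σ → length σ ≡ suc j → All (1 <_) σ → D true (σ ++ 1 ∷ []) ≈ D true σ * wt b
        descentAtMin (s ∷ σ) lenσ 1<σ = trans (D-minLast true s σ 1 1<σ)
          (reflexive (≡.cong (λ i → D true (s ∷ σ) * wt (shift i true)) (≡.cong ℕ.pred lenσ)))
      total : ∀ j S S′ → j ≤ m → length S ≡ j → length S′ ≡ m ∸ j →
              StrictlySorted false S → All (1 <_) S → StrictlySorted false S′ → All (1 <_) S′ →
              ∑Arr j S (λ σ → D true (σ ++ 1 ∷ [])) * ∑Arr (m ∸ j) S′ (D (not (shift j true)))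
                ≈ leftOfMin j * Aᵇ (not (shift j true)) (m ∸ j)
      total j S S′ _ lenS lenS′ sS 1<S sS′ _ =
        *-cong (leftTotal j S lenS sS 1<S) (∑Arr-sorted false _ (m ∸ j) S′ sS′ lenS′)

    -- The products C(m, j) A_j A_{m-j} at an even j = 2i (right factor read with p and q
    -- exchanged) and at an odd j = 2i + 1; below, the terms of both insertion formulas are
    -- evaluated to these according to the parity of j.
    evenProduct oddProduct : ℕ → ℕ → Carrier
    evenProduct m i = fromℕ R (m C (2 ℕ.* i)) * A R (2 ℕ.* i) p q * A R (m ∸ 2 ℕ.* i) q p
    oddProduct  m i = fromℕ R (m C suc (2 ℕ.* i)) * A R (suc (2 ℕ.* i)) p q * A R (m ∸ suc (2 ℕ.* i)) p q

    rightOfMax-even : ∀ i x → 0 < x → rightOfMax (2 ℕ.* i) x ≈ p * A R x q p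
    rightOfMax-even i (suc r) _ rewrite shift-even i true = refl

    rightOfMax-odd : ∀ i x → 0 < x → rightOfMax (suc (2 ℕ.* i)) x ≈ q * A R x p q
    rightOfMax-odd i (suc r) _ rewrite shift-even i false = refl

    maxTerm-even : ∀ m i → 2 ℕ.* i < m → maxTerm m (2 ℕ.* i) ≈ p * evenProduct m i
    maxTerm-even m i 2i<m = trans (*-congˡ (*-congˡ (rightOfMax-even i (m ∸ 2 ℕ.* i) (ℕP.m<n⇒0<n∸m 2i<m))))
                                  (Rearrange.pull-right _ _ _ _)

    maxTerm-odd : ∀ m i → suc (2 ℕ.* i) < m → maxTerm m (suc (2 ℕ.* i)) ≈ q * oddProduct m i
    maxTerm-odd m i 2i+1<m = trans (*-congˡ (*-congˡ (rightOfMax-odd i (m ∸ suc (2 ℕ.* i)) (ℕP.m<n⇒0<n∸m 2i+1<m))))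
                                   (Rearrange.pull-right _ _ _ _)

    maxTerm-last : ∀ m → maxTerm m m ≈ A R m p q
    maxTerm-last m = begin
      fromℕ R (m C m) * (A R m p q * rightOfMax m (m ∸ m)) ≡⟨ ≡.cong (λ r → fromℕ R (m C m) * (A R m p q * rightOfMax m r)) (ℕP.n∸n≡0 m) ⟩
      fromℕ R (m C m) * (A R m p q * 1#)                  ≈⟨ *-cong (C-diagonal m) (*-identityʳ _) ⟩
      1# * A R m p q                                      ≈⟨ *-identityˡ _ ⟩
      A R m p q                                           ∎

    minTerm-first : ∀ m → minTerm m 0 ≈ A R m q p
    minTerm-first m = trans (*-cong (+-identityʳ 1#) (*-identityˡ _)) (*-identityˡ _)

    minTerm-odd : ∀ m i → minTerm m (suc (2 ℕ.* i)) ≈ p * oddProduct m i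
    minTerm-odd m i rewrite shift-even i true | shift-even i false = Rearrange.pull-middle _ _ _ _

    minTerm-even : ∀ m i → minTerm m (suc (suc (2 ℕ.* i))) ≈ q * evenProduct m (suc i)
    minTerm-even m i rewrite shift-even i true | shift-even i false = trans (Rearrange.pull-middle _ _ _ _)
      (reflexive (≡.cong (λ j → q * (fromℕ R (m C j) * A R j p q * A R (m ∸ j) q p)) (≡.sym (ℕP.*-suc 2 i))))

    A-odd-byMax : ∀ n → A R (suc (2 ℕ.* n)) p q
                      ≈ A R (2 ℕ.* n) p q + p * Σ< n (evenProduct (2 ℕ.* n)) + q * Σ< n (oddProduct (2 ℕ.* n))
    A-odd-byMax n = begin
      A R (suc m) p q                                                  ≈⟨ maxInsertion m ⟩
      Σ< (suc m) (maxTerm m)                                           ≈⟨ Σ<-last m (maxTerm m) ⟩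
      Σ< m (maxTerm m) + maxTerm m m                                   ≈⟨ +-cong (Σ<-pairs n (maxTerm m)) (maxTerm-last m) ⟩
      Σ< n (λ i → maxTerm m (2 ℕ.* i) + maxTerm m (suc (2 ℕ.* i))) + A R m p q
        ≈⟨ +-congʳ (Σ<-cong n (λ i i<n → +-cong (maxTerm-even m i (ℕP.<-trans (ℕP.n<1+n _) (odd<even i<n)))
                                                 (maxTerm-odd m i (odd<even i<n)))) ⟩
      Σ< n (λ i → p * evenProduct m i + q * oddProduct m i) + A R m p q ≈⟨ +-congʳ (Σ<-linear n p q _ _) ⟩
      (p * Σ< n (evenProduct m) + q * Σ< n (oddProduct m)) + A R m p q  ≈⟨ Rearrange.last-to-front _ _ _ ⟩
      A R m p q + p * Σ< n (evenProduct m) + q * Σ< n (oddProduct m)    ∎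
      where m = 2 ℕ.* n

    A-odd-byMin : ∀ k → A R (suc (2 ℕ.* k)) p q
                      ≈ A R (2 ℕ.* k) q p + p * Σ< k (oddProduct (2 ℕ.* k)) + q * Σ< k (evenProduct (2 ℕ.* k) ∘ suc)
    A-odd-byMin k = begin
      A R (suc m) p q                                  ≈⟨ minInsertion m ⟩
      Σ< (suc m) (minTerm m)                           ≈⟨ Σ<-suc m (minTerm m) ⟩
      minTerm m 0 + Σ< m (minTerm m ∘ suc)             ≈⟨ +-cong (minTerm-first m) (Σ<-pairs k (minTerm m ∘ suc)) ⟩
      A R m q p + Σ< k (λ i → minTerm m (suc (2 ℕ.* i)) + minTerm m (suc (suc (2 ℕ.* i))))
        ≈⟨ +-congˡ (∑-cong (upTo k) (λ i → +-cong (minTerm-odd m i) (minTerm-even m i))) ⟩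
      A R m q p + Σ< k (λ i → p * oddProduct m i + q * evenProduct m (suc i))
        ≈⟨ +-congˡ (Σ<-linear k p q _ _) ⟩
      A R m q p + (p * Σ< k (oddProduct m) + q * Σ< k (evenProduct m ∘ suc))
        ≈⟨ sym (+-assoc _ _ _) ⟩
      A R m q p + p * Σ< k (oddProduct m) + q * Σ< k (evenProduct m ∘ suc) ∎
      where m = 2 ℕ.* k

  -- By strong induction: the maximum-
  -- insertion expansion of A_{2k+1}(q, p) agrees with the minimum-insertion expansion of
  -- A_{2k+1}(p, q) after reflecting the even sum and using symmetry for smaller odd lengths.
  A-odd-symmetric : ∀ p q k → A R (suc (2 ℕ.* k)) q p ≈ A R (suc (2 ℕ.* k)) p q
  A-odd-symmetric p q = <-rec (λ k → A R (suc (2 ℕ.* k)) q p ≈ A R (suc (2 ℕ.* k)) p q) step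
    where
    open Weighted p q using (evenProduct; oddProduct; A-odd-byMin)
    module Swapped = Weighted q p
    step : ∀ k → (∀ {i} → i < k → A R (suc (2 ℕ.* i)) q p ≈ A R (suc (2 ℕ.* i)) p q) →
           A R (suc (2 ℕ.* k)) q p ≈ A R (suc (2 ℕ.* k)) p q
    step k IH = begin
      A R (suc m) q p
        ≈⟨ Swapped.A-odd-byMax k ⟩
      A R m q p + q * Σ< k (Swapped.evenProduct m) + p * Σ< k (Swapped.oddProduct m)
        ≈⟨ +-cong (+-congˡ (*-congˡ evenReflected)) (*-congˡ (Σ<-cong k oddSymmetric)) ⟩
      A R m q p + q * Σ< k (evenProduct m ∘ suc) + p * Σ< k (oddProduct m)
        ≈⟨ Rearrange.swap-summands _ _ _ ⟩
      A R m q p + p * Σ< k (oddProduct m) + q * Σ< k (evenProduct m ∘ suc)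
        ≈⟨ sym (A-odd-byMin k) ⟩
      A R (suc m) p q ∎
      where
      m = 2 ℕ.* k
      evenReflected : Σ< k (Swapped.evenProduct m) ≈ Σ< k (evenProduct m ∘ suc)
      evenReflected = trans (Σ<-reverse k _) (Σ<-cong k (λ i i<k → trans
        (reflexive (≡.cong (λ j → fromℕ R (m C j) * A R j q p * A R (m ∸ j) p q) (ℕP.*-distribˡ-∸ 2 k (suc i))))
        (binomial-reflect m (2 ℕ.* suc i) (λ j → A R j q p) (λ j → A R j p q) (ℕP.*-monoʳ-≤ 2 i<k))))
      oddSymmetric : ∀ i → i < k → Swapped.oddProduct m i ≈ oddProduct m i
      oddSymmetric i i<k = *-cong (*-congˡ (IH i<k)) (≡.subst (λ j → A R j q p ≈ A R j p q)
        (≡.sym (odd-complement k i i<k)) (IH (ℕP.∸-monoʳ-< {k} (s≤s z≤n) i<k)))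

  -- A_{2k+2} by inserting the maximum, with the even-position sum reflected onto the odd
  -- one by the symmetry of odd-length polynomials: the first identity of the theorem.
  A-even-byMax : ∀ p q k → A R (suc (suc (2 ℕ.* k))) p q
               ≈ (1# + p) * A R (suc (2 ℕ.* k)) p q + (p + q) * Σ< k (Weighted.oddProduct p q (suc (2 ℕ.* k)))
  A-even-byMax p q k = begin
    A R (suc m) p q                                   ≈⟨ maxInsertion m ⟩
    Σ< (suc m) (maxTerm m)                            ≡⟨ ≡.cong (λ n → Σ< n (maxTerm m)) (≡.sym (ℕP.*-suc 2 k)) ⟩
    Σ< (2 ℕ.* suc k) (maxTerm m)                      ≈⟨ Σ<-pairs (suc k) (maxTerm m) ⟩
    Σ< (suc k) (λ i → maxTerm m (2 ℕ.* i) + maxTerm m (suc (2 ℕ.* i)))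
      ≈⟨ ∑-+ _ _ (upTo (suc k)) ⟩
    Σ< (suc k) (λ i → maxTerm m (2 ℕ.* i)) + Σ< (suc k) (λ i → maxTerm m (suc (2 ℕ.* i)))
      ≈⟨ +-cong evenPart oddPart ⟩
    p * (Σ< k (oddProduct m) + A R m p q) + (q * Σ< k (oddProduct m) + A R m p q)
      ≈⟨ Rearrange.collect _ _ _ _ ⟩
    (1# + p) * A R m p q + (p + q) * Σ< k (oddProduct m) ∎
    where
    open Weighted p q
    m = suc (2 ℕ.* k)
    lastOdd : oddProduct m k ≈ A R m p q
    lastOdd = begin
      fromℕ R (m C m) * A R m p q * A R (m ∸ m) p q ≡⟨ ≡.cong (λ r → fromℕ R (m C m) * A R m p q * A R r p q) (ℕP.n∸n≡0 m) ⟩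
      fromℕ R (m C m) * A R m p q * (1# + 0#)       ≈⟨ *-cong (*-congʳ (C-diagonal m)) (+-identityʳ 1#) ⟩
      1# * A R m p q * 1#                           ≈⟨ trans (*-identityʳ _) (*-identityˡ _) ⟩
      A R m p q                                     ∎
    reflected : ∀ i → i < suc k → evenProduct m (k ∸ i) ≈ oddProduct m i
    reflected i i<1+k = begin
      evenProduct m (k ∸ i)
        ≡⟨ ≡.cong (λ j → fromℕ R (m C j) * A R j p q * A R (m ∸ j) q p) (ℕP.*-distribˡ-∸ 2 k i) ⟩
      fromℕ R (m C (m ∸ suc (2 ℕ.* i))) * A R (m ∸ suc (2 ℕ.* i)) p q * A R (m ∸ (m ∸ suc (2 ℕ.* i))) q p
        ≈⟨ binomial-reflect m (suc (2 ℕ.* i)) (λ j → A R j p q) (λ j → A R j q p) (s≤s (ℕP.*-monoʳ-≤ 2 (ℕP.≤-pred i<1+k))) ⟩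
      fromℕ R (m C suc (2 ℕ.* i)) * A R (suc (2 ℕ.* i)) q p * A R (m ∸ suc (2 ℕ.* i)) p q
        ≈⟨ *-congʳ (*-congˡ (A-odd-symmetric p q i)) ⟩
      oddProduct m i ∎
    evenPart : Σ< (suc k) (λ i → maxTerm m (2 ℕ.* i)) ≈ p * (Σ< k (oddProduct m) + A R m p q)
    evenPart = begin
      Σ< (suc k) (λ i → maxTerm m (2 ℕ.* i))
        ≈⟨ Σ<-cong (suc k) (λ i i<1+k → maxTerm-even m i (s≤s (ℕP.*-monoʳ-≤ 2 (ℕP.≤-pred i<1+k)))) ⟩
      Σ< (suc k) (λ i → p * evenProduct m i)   ≈⟨ sym (∑-*ˡ p _ (upTo (suc k))) ⟩
      p * Σ< (suc k) (evenProduct m)            ≈⟨ *-congˡ (Σ<-reverse (suc k) _) ⟩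
      p * Σ< (suc k) (λ i → evenProduct m (k ∸ i)) ≈⟨ *-congˡ (Σ<-cong (suc k) reflected) ⟩
      p * Σ< (suc k) (oddProduct m)             ≈⟨ *-congˡ (trans (Σ<-last k _) (+-congˡ lastOdd)) ⟩
      p * (Σ< k (oddProduct m) + A R m p q)     ∎
    oddPart : Σ< (suc k) (λ i → maxTerm m (suc (2 ℕ.* i))) ≈ q * Σ< k (oddProduct m) + A R m p q
    oddPart = begin
      Σ< (suc k) (λ i → maxTerm m (suc (2 ℕ.* i)))              ≈⟨ Σ<-last k _ ⟩
      Σ< k (λ i → maxTerm m (suc (2 ℕ.* i))) + maxTerm m m      ≈⟨ +-cong (Σ<-cong k (λ i i<k → maxTerm-odd m i (ℕP.m<n⇒m<1+n (odd<even i<k)))) (maxTerm-last m) ⟩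
      Σ< k (λ i → q * oddProduct m i) + A R m p q               ≈⟨ +-congʳ (sym (∑-*ˡ q _ (upTo k))) ⟩
      q * Σ< k (oddProduct m) + A R m p q                       ∎

lemma2p1 : {c ℓ : Level} (R : CommutativeSemiring c ℓ) →
    let open CommutativeSemiring R in
    (p q : Carrier) (n : ℕ) → 1 ≤ n →
      (A R (2 ℕ.* n) p q ≈
        (1# + p) * A R (2 ℕ.* n ∸ 1) p q
        + (p + q) * Σ[_⋯_] R 1 (n ∸ 1) (λ i →
            fromℕ R ((2 ℕ.* n ∸ 1) C (2 ℕ.* i ∸ 1))
            * A R (2 ℕ.* i ∸ 1) p q * A R (2 ℕ.* n ∸ 2 ℕ.* i) p q))
      ×
      (A R (suc (2 ℕ.* n)) p q ≈
        A R (2 ℕ.* n) p q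
        + p * Σ[_⋯_] R 0 (n ∸ 1) (λ i →
            fromℕ R ((2 ℕ.* n) C (2 ℕ.* i))
            * A R (2 ℕ.* i) p q * A R (2 ℕ.* n ∸ 2 ℕ.* i) q p)
        + q * Σ[_⋯_] R 1 n (λ i →
            fromℕ R ((2 ℕ.* n) C (2 ℕ.* i ∸ 1))
            * A R (2 ℕ.* i ∸ 1) p q * A R (suc (2 ℕ.* n) ∸ 2 ℕ.* i) p q))
lemma2p1 R p q (suc k) (s≤s z≤n) = firstIdentity , secondIdentity
  where
  open CommutativeSemiring R
  open Eulerian R
  open Weighted p q using (oddProduct; A-odd-byMax)

  -- The statement indexes the odd summands by i + 1, through 2(i + 1) - 1 = 2i + 1.
  oddSummand : ∀ M i → fromℕ R (M C (2 ℕ.* suc i ∸ 1)) * A R (2 ℕ.* suc i ∸ 1) p q * A R (suc M ∸ 2 ℕ.* suc i) p q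
                       ≈ oddProduct M i
  oddSummand M i = reflexive (≡.cong (λ j → fromℕ R (M C (j ∸ 1)) * A R (j ∸ 1) p q * A R (suc M ∸ j) p q) (ℕP.*-suc 2 i))

  -- The first identity with 2n written as 2k + 2.
  firstIdentity = ≡.subst
    (λ N → A R N p q ≈ (1# + p) * A R (N ∸ 1) p q
             + (p + q) * Σ< k (λ i → fromℕ R ((N ∸ 1) C (2 ℕ.* suc i ∸ 1)) * A R (2 ℕ.* suc i ∸ 1) p q * A R (N ∸ 2 ℕ.* suc i) p q))
    (≡.sym (ℕP.*-suc 2 k))
    (trans (A-even-byMax p q k) (+-congˡ (*-congˡ (sym (∑-cong (upTo k) (oddSummand (suc (2 ℕ.* k))))))))

  secondIdentity = trans (A-odd-byMax (suc k)) (+-congˡ (*-congˡ (sym (∑-cong (upTo (suc k)) (oddSummand (2 ℕ.* suc k))))))
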